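{- Let $\mathbb{F}_q$ be a finite field, $a,b\in\mathbb{F}_q$ with $b\neq0$, and $Q=\begin{pmatrix} a & b\\ 1 & 0\end{pmatrix}$, and suppose $x^2-ax-b$ splits over $\mathbb{F}_q$ into distinct roots. Suppose the multiplicative order $r$ of $-b$ in $\mathbb{F}_q^\times$ is a prime. Then the lengths of the non-trivial orbits of $G=\langle Q\rangle$ acting on $\mathbb{F}_q\times\mathbb{F}_q$ are of one of two types: (a) all non-trivial orbits have the same length $m$, where $r\mid m$; or (b) there are orbits of length $m$ and orbits of length $rm$ (and no others), where $r\nmid m$. In particular, if $b=1$ and $\mathbb{F}_q$ has odd characteristic, then either (c) all non-trivial orbits have the same even length $m$, or (d) there are orbits of lengths $m$ and $2m$ (and no others), where $m$ is odd.
   Context: $G=\langle Q\rangle$ acts on $\mathbb{F}_q\times\mathbb{F}_q$ (column vectors) by $v\mapsto Q^nv$. The length of an orbit is its number of elements; non-trivial orbits are orbits of non-zero vectors. -}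

module Defs where

open import Level using (Level; 0ℓ)
open import Data.Nat using (ℕ; zero; suc; _<_; _≤_)
open import Data.Product using (Σ; _×_; _,_; ∃)
open import Data.List using (List; length)
open import Data.List.Membership.Propositional using (_∈_)
open import Data.List.Relation.Unary.Unique.Propositional using (Unique)
open import Relation.Binary.PropositionalEquality using (_≡_)
open import Relation.Nullary using (¬_)
open import Algebra.Structures using (IsCommutativeRing)
open import Function.Bundles using (_⇔_)

record FiniteField : Set₁ where
  infixl 6 _+_
  infixl 7 _*_
  field
    Carrier : Set
    _+_ _*_ : Carrier → Carrier → Carrier
    -_      : Carrier → Carrier
    0# 1#   : Carrier
    isCommutativeRing : IsCommutativeRing _≡_ _+_ _*_ -_ 0# 1#
    0≢1     : ¬ (0# ≡ 1#)
    inverse : ∀ x → ¬ (x ≡ 0#) → Σ Carrier (λ y → x * y ≡ 1#)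
    elements : List Carrier
    elements-unique   : Unique elements
    elements-complete : ∀ x → x ∈ elements

module _ (F : FiniteField) where
  open FiniteField F

  _^_ : Carrier → ℕ → Carrier
  x ^ zero  = 1#
  x ^ suc n = x * (x ^ n)

  IsMultOrder : Carrier → ℕ → Set
  IsMultOrder x r = (0 < r) × (x ^ r ≡ 1#) × (∀ k → 0 < k → x ^ k ≡ 1# → r ≤ k)

  -- x² - a x - b splits over F into distinct roots λ, μ:
  -- x² - a x - b = (x - λ)(x - μ) = x² - (λ + μ) x + λ μ as polynomials
  SplitsDistinct : Carrier → Carrier → Set
  SplitsDistinct a b = Σ Carrier λ l → Σ Carrier λ m →
    ¬ (l ≡ m) × (l + m ≡ a) × (l * m ≡ - b)

  Vec2 : Set
  Vec2 = Carrier × Carrier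

  zeroV : Vec2
  zeroV = 0# , 0#

  -- Q = [[a , b] , [1 , 0]] acting on column vectors
  Qmul : Carrier → Carrier → Vec2 → Vec2
  Qmul a b (x , y) = (a * x + b * y) , x

  Qpow : Carrier → Carrier → ℕ → Vec2 → Vec2
  Qpow a b zero    v = v
  Qpow a b (suc n) v = Qmul a b (Qpow a b n v)

  -- w lies in the orbit of v under G = ⟨Q⟩ (G finite, so ⟨Q⟩ = {Q^n | n ∈ ℕ})
  InOrbit : Carrier → Carrier → Vec2 → Vec2 → Set
  InOrbit a b v w = ∃ λ n → Qpow a b n v ≡ w

  OrbitLength : Carrier → Carrier → Vec2 → ℕ → Set
  OrbitLength a b v m = Σ (List Vec2) λ os →
    (length os ≡ m) × Unique os × (∀ w → (w ∈ os) ⇔ InOrbit a b v w)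

  NonZeroV : Vec2 → Set
  NonZeroV v = ¬ (v ≡ zeroV)

-- Q is diagonalisable: for the roots l ≠ m of X² - aX - b, the linear forms φ(x , y) = x - m y and
-- ψ(x , y) = x - l y satisfy φ ∘ Q = l φ and ψ ∘ Q = m ψ, and together they determine a vector.  So Q^n
-- fixes v ≠ 0 exactly when ord l ∣ n (if φ v ≠ 0) and ord m ∣ n (if ψ v ≠ 0), and every non-trivial
-- orbit has length ord l, ord m or their lcm.  As l m = -b has order r, any two of l^n = 1, m^n = 1,
-- (l m)^n = 1 imply the third; for prime r this leaves only ord l = ord m with r ∣ ord l, or one order
-- equal to r times the other with r not dividing the smaller.  For b = 1 in odd characteristic,
-- -b = -1 has order 2.
module Submission where

open import Defs hiding (_^_)
import Defs
open import Level using (0ℓ)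
open import Data.Nat using (ℕ; zero; suc; _<_; _≤_; z≤n; s≤s)
import Data.Nat as ℕ
import Data.Nat.Properties as ℕ
open import Data.Nat.Divisibility using (_∣_; >⇒∤; divides; ∣-refl; ∣-trans; ∣-antisym; n∣m*n; m∣m*n; *-cancelʳ-∣; _∣?_; m%n≡0⇒n∣m)
open import Data.Nat.DivMod using (_%_; _/_; m%n<n; m≡m%n+[m/n]*n)
open import Data.Nat.Coprimality using (Coprime; coprime-divisor)
open import Data.Nat.Primality using (Prime; prime⇒irreducible; prime[2])
open import Data.Fin using (Fin; toℕ; fromℕ<)
import Data.Fin.Properties as Fin
open import Data.List using (length; lookup; tabulate)
open import Data.List.Properties using (length-tabulate)
open import Data.List.Membership.Propositional using (_∈_)
open import Data.List.Membership.Propositional.Properties using (∈-tabulate⁺; ∈-tabulate⁻)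
import Data.List.Relation.Unary.Unique.Propositional.Properties as Unique
open import Data.List.Relation.Unary.Any using (index)
open import Data.List.Relation.Unary.Any.Properties using (lookup-index)
open import Data.Product using (Σ; _×_; _,_; ∃; proj₁; proj₂)
open import Data.Sum using (_⊎_; inj₁; inj₂; [_,_]′)
open import Algebra.Bundles using (CommutativeRing)
open import Function using (_∘_)
open import Function.Bundles using (_⇔_; mk⇔; Equivalence)
open import Relation.Binary.Definitions using (DecidableEquality; tri<; tri≈; tri>)
open import Relation.Binary.PropositionalEquality
open import Relation.Nullary using (¬_; yes; no; contradiction)
open import Relation.Nullary.Decidable using (map′)
open import Relation.Unary using (Decidable)

module NumberTheory where
  open import Data.Nat using (_*_)
  open import Data.Nat.Properties using (*-identityˡ)

  -- The divisibility pattern of the orders A, B, C of g, h and g h in an abelian group.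
  record TwoOfThree (A B C : ℕ) : Set where
    field
      AB⇒C : ∀ {n} → A ∣ n → B ∣ n → C ∣ n
      BC⇒A : ∀ {n} → B ∣ n → C ∣ n → A ∣ n
      CA⇒B : ∀ {n} → C ∣ n → A ∣ n → B ∣ n

  twoOfThree-swap : ∀ {A B C} → TwoOfThree A B C → TwoOfThree B A C
  twoOfThree-swap t = record
    { AB⇒C = λ b a → AB⇒C a b ; BC⇒A = λ a c → CA⇒B c a ; CA⇒B = λ c b → BC⇒A b c }
    where open TwoOfThree t

  prime∤⇒coprime : ∀ {r n} → Prime r → ¬ r ∣ n → Coprime n r
  prime∤⇒coprime pr r∤n (d∣n , d∣r) with prime⇒irreducible pr d∣r
  ... | inj₁ d≡1 = d≡1
  ... | inj₂ refl = contradiction d∣n r∤n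

  -- B ∣ A ∣ r B, and r is prime, so A / B is 1 or r; it is not 1 as r ∣ A but r ∤ B.
  twoOfThree-prime-∣⇒≡r* : ∀ {A B r} → Prime r → 0 < B → TwoOfThree A B r →
    r ∣ A → ¬ r ∣ B → A ≡ r * B
  twoOfThree-prime-∣⇒≡r* {A} {B@(suc _)} {r} pr _ t r∣A r∤B with TwoOfThree.CA⇒B t r∣A ∣-refl
  ... | divides q A≡qB with prime⇒irreducible pr q∣r
    where
    q∣r : q ∣ r
    q∣r = *-cancelʳ-∣ {q} {r} B (subst (_∣ r * B) A≡qB (TwoOfThree.BC⇒A t (n∣m*n r) (m∣m*n B)))
  ...   | inj₁ refl = contradiction (subst (r ∣_) (trans A≡qB (*-identityˡ B)) r∣A) r∤B
  ...   | inj₂ refl = A≡qB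

  twoOfThree-prime-cases : ∀ {A B r} → Prime r → 0 < A → 0 < B → TwoOfThree A B r →
    (A ≡ B × r ∣ A) ⊎ (A ≡ r * B × ¬ r ∣ B) ⊎ (B ≡ r * A × ¬ r ∣ A)
  twoOfThree-prime-cases {A} {B} {r} pr 0<A 0<B t with r ∣? A | r ∣? B
  ... | yes r∣A | yes r∣B = inj₁ (∣-antisym (BC⇒A ∣-refl r∣B) (CA⇒B r∣A ∣-refl) , r∣A)
    where open TwoOfThree t
  ... | yes r∣A | no r∤B = inj₂ (inj₁ (twoOfThree-prime-∣⇒≡r* pr 0<B t r∣A r∤B , r∤B))
  ... | no r∤A | yes r∣B =
    inj₂ (inj₂ (twoOfThree-prime-∣⇒≡r* pr 0<A (twoOfThree-swap t) r∣B r∤A , r∤A))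
  ... | no r∤A | no r∤B = contradiction (AB⇒C ∣-refl B∣A) r∤A
    where
    open TwoOfThree t
    B∣A : B ∣ A
    B∣A = coprime-divisor (prime∤⇒coprime pr r∤B) (CA⇒B (m∣m*n A) (n∣m*n r))

  least-below : {P : ℕ → Set} → Decidable P → ∀ n →
    (∃ λ k → k < n × P k × ∀ j → j < k → ¬ P j) ⊎ (∀ j → j < n → ¬ P j)
  least-below P? zero = inj₂ λ _ ()
  least-below P? (suc n) with least-below P? n
  ... | inj₁ (k , k<n , pk , below) = inj₁ (k , ℕ.m<n⇒m<1+n k<n , pk , below)
  ... | inj₂ none with P? n
  ...   | yes pn = inj₁ (n , ℕ.n<1+n n , pn , none)
  ...   | no ¬pn = inj₂ λ j j<1+n → [ none j , (λ { refl → ¬pn }) ]′ (ℕ.m<1+n⇒m<n∨m≡n j<1+n)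

  least-witness : {P : ℕ → Set} → Decidable P → ∀ {n} → P n → ∃ λ k → P k × ∀ j → P j → k ≤ j
  least-witness P? {n} pn with least-below P? (suc n)
  ... | inj₁ (k , _ , pk , below) = k , pk , λ j pj → ℕ.≮⇒≥ λ j<k → below j j<k pj
  ... | inj₂ none = contradiction pn (none n (ℕ.n<1+n n))

open NumberTheory

module FieldFacts (F : FiniteField) where
  open FiniteField F public using (Carrier; 0≢1)
  open FiniteField F using (inverse; elements; elements-complete; isCommutativeRing)

  commutativeRing : CommutativeRing 0ℓ 0ℓ
  commutativeRing = record { isCommutativeRing = isCommutativeRing }

  open CommutativeRing commutativeRing public
    using (_+_; _*_; -_; _-_; 0#; 1#; ring; commutativeSemiring; +-commutativeSemigroup
          ; +-assoc; +-comm; -‿inverseʳ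
          ; *-assoc; *-comm; *-identityˡ; *-identityʳ; distribʳ; zeroˡ; zeroʳ)
  open import Algebra.Properties.Ring ring public
    using (-‿involutive; -0#≈0#; -‿distribˡ-*; -1*x≈-x; +-cancelˡ; x∙y⁻¹≈ε⇒x≈y
          ; //-rightDividesʳ; //-rightDividesˡ; \\-leftDividesʳ; [y-z]x≈yx-zx; x[y-z]≈xy-xz)
  open import Algebra.Properties.CommutativeSemigroup +-commutativeSemigroup public using (xy∙z≈xz∙y)
  open import Algebra.Properties.CommutativeSemiring.Exp commutativeSemiring
    using (^-homo-*; ^-distrib-*)
    renaming (_^_ to _^ˢ_)

  infixr 8 _^_
  _^_ : Carrier → ℕ → Carrier
  _^_ = Defs._^_ F

  position : Carrier → Fin (length elements)
  position x = index (elements-complete x)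

  position-injective : ∀ {x y} → position x ≡ position y → x ≡ y
  position-injective {x} {y} eq = begin
    x                             ≡⟨ lookup-index (elements-complete x) ⟩
    lookup elements (position x)  ≡⟨ cong (lookup elements) eq ⟩
    lookup elements (position y)  ≡⟨ lookup-index (elements-complete y) ⟨
    y                             ∎
    where open ≡-Reasoning

  infix 4 _≟_
  _≟_ : DecidableEquality Carrier
  x ≟ y = map′ position-injective (cong position) (position x Fin.≟ position y)

  *-cancelˡ-≢0 : ∀ {x y z} → x ≢ 0# → x * y ≡ x * z → y ≡ z
  *-cancelˡ-≢0 {x} {y} {z} x≢0 xy≡xz with inverse x x≢0
  ... | x⁻¹ , xx⁻¹≡1 = begin
    y              ≡⟨ *-identityˡ y ⟨
    1# * y         ≡⟨ cong (_* y) x⁻¹x≡1 ⟨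
    (x⁻¹ * x) * y  ≡⟨ *-assoc x⁻¹ x y ⟩
    x⁻¹ * (x * y)  ≡⟨ cong (x⁻¹ *_) xy≡xz ⟩
    x⁻¹ * (x * z)  ≡⟨ *-assoc x⁻¹ x z ⟨
    (x⁻¹ * x) * z  ≡⟨ cong (_* z) x⁻¹x≡1 ⟩
    1# * z         ≡⟨ *-identityˡ z ⟩
    z              ∎
    where
    open ≡-Reasoning
    x⁻¹x≡1 : x⁻¹ * x ≡ 1#
    x⁻¹x≡1 = trans (*-comm x⁻¹ x) xx⁻¹≡1

  *-≢0 : ∀ {x y} → x ≢ 0# → y ≢ 0# → x * y ≢ 0#
  *-≢0 {x} x≢0 y≢0 xy≡0 = y≢0 (*-cancelˡ-≢0 x≢0 (trans xy≡0 (sym (zeroʳ x))))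

  *-≢0⇒≢0ˡ : ∀ {x y} → x * y ≢ 0# → x ≢ 0#
  *-≢0⇒≢0ˡ {y = y} xy≢0 refl = xy≢0 (zeroˡ y)

  *-≢0⇒≢0ʳ : ∀ {x y} → x * y ≢ 0# → y ≢ 0#
  *-≢0⇒≢0ʳ {x} xy≢0 refl = xy≢0 (zeroʳ x)

  -‿≢0 : ∀ {x} → x ≢ 0# → - x ≢ 0#
  -‿≢0 {x} x≢0 -x≡0 = x≢0 (trans (sym (-‿involutive x)) (trans (cong -_ -x≡0) -0#≈0#))

  ≢⇒-≢0 : ∀ {x y} → x ≢ y → x - y ≢ 0#
  ≢⇒-≢0 {x} {y} x≢y x-y≡0 = x≢y (x∙y⁻¹≈ε⇒x≈y x y x-y≡0)

  *-fix⇒≡1 : ∀ {t c} → c ≢ 0# → t * c ≡ c → t ≡ 1#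
  *-fix⇒≡1 {t} {c} c≢0 tc≡c = *-cancelˡ-≢0 c≢0 (trans (*-comm c t) (trans tc≡c (sym (*-identityʳ c))))

  ≡1⇒*-fix : ∀ {t c} → (c ≢ 0# → t ≡ 1#) → t * c ≡ c
  ≡1⇒*-fix {t} {c} t≡1 with c ≟ 0#
  ... | yes refl = zeroʳ t
  ... | no c≢0 = trans (cong (_* c) (t≡1 c≢0)) (*-identityˡ c)

  ^≗^ˢ : ∀ x n → x ^ n ≡ x ^ˢ n
  ^≗^ˢ x zero = refl
  ^≗^ˢ x (suc n) = cong (x *_) (^≗^ˢ x n)

  ^-homo-+ : ∀ x m n → x ^ (m ℕ.+ n) ≡ x ^ m * x ^ n
  ^-homo-+ x m n = begin
    x ^ (m ℕ.+ n)    ≡⟨ ^≗^ˢ x (m ℕ.+ n) ⟩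
    x ^ˢ (m ℕ.+ n)   ≡⟨ ^-homo-* x m n ⟩
    x ^ˢ m * x ^ˢ n  ≡⟨ cong₂ _*_ (^≗^ˢ x m) (^≗^ˢ x n) ⟨
    x ^ m * x ^ n    ∎
    where open ≡-Reasoning

  ^-distribʳ-* : ∀ x y n → (x * y) ^ n ≡ x ^ n * y ^ n
  ^-distribʳ-* x y n = begin
    (x * y) ^ n      ≡⟨ ^≗^ˢ (x * y) n ⟩
    (x * y) ^ˢ n     ≡⟨ ^-distrib-* x y n ⟩
    x ^ˢ n * y ^ˢ n  ≡⟨ cong₂ _*_ (^≗^ˢ x n) (^≗^ˢ y n) ⟨
    x ^ n * y ^ n    ∎
    where open ≡-Reasoning

  ^-≢0 : ∀ {x} → x ≢ 0# → ∀ n → x ^ n ≢ 0#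
  ^-≢0 x≢0 zero = 0≢1 ∘ sym
  ^-≢0 x≢0 (suc n) = *-≢0 x≢0 (^-≢0 x≢0 n)

  ^≡1⇒^-*≡1 : ∀ {x n} → x ^ n ≡ 1# → ∀ q → x ^ (q ℕ.* n) ≡ 1#
  ^≡1⇒^-*≡1 xⁿ≡1 zero = refl
  ^≡1⇒^-*≡1 {x} {n} xⁿ≡1 (suc q) = begin
    x ^ (n ℕ.+ q ℕ.* n)    ≡⟨ ^-homo-+ x n (q ℕ.* n) ⟩
    x ^ n * x ^ (q ℕ.* n)  ≡⟨ cong₂ _*_ xⁿ≡1 (^≡1⇒^-*≡1 xⁿ≡1 q) ⟩
    1# * 1#                ≡⟨ *-identityˡ 1# ⟩
    1#                     ∎
    where open ≡-Reasoning

  -- Pigeonhole: 1, x, …, x^|F| cannot all be distinct.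
  ^-period : ∀ {x} → x ≢ 0# → ∃ λ N → x ^ suc N ≡ 1#
  ^-period {x} x≢0 with Fin.pigeonhole (ℕ.n<1+n _) (λ i → position (x ^ toℕ i))
  ... | i , j , i<j , same = N , *-cancelˡ-≢0 (^-≢0 x≢0 (toℕ i)) xⁱ⁺ᴺ⁺¹≡xⁱ
    where
    open ≡-Reasoning
    N : ℕ
    N = toℕ j ℕ.∸ suc (toℕ i)
    i+N+1≡j : toℕ i ℕ.+ suc N ≡ toℕ j
    i+N+1≡j = trans (ℕ.+-suc (toℕ i) N) (ℕ.m+[n∸m]≡n i<j)
    xⁱ⁺ᴺ⁺¹≡xⁱ : x ^ toℕ i * x ^ suc N ≡ x ^ toℕ i * 1#
    xⁱ⁺ᴺ⁺¹≡xⁱ = begin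
      x ^ toℕ i * x ^ suc N  ≡⟨ ^-homo-+ x (toℕ i) (suc N) ⟨
      x ^ (toℕ i ℕ.+ suc N)  ≡⟨ cong (x ^_) i+N+1≡j ⟩
      x ^ toℕ j              ≡⟨ position-injective same ⟨
      x ^ toℕ i              ≡⟨ *-identityʳ (x ^ toℕ i) ⟨
      x ^ toℕ i * 1#         ∎

  order-exists : ∀ {x} → x ≢ 0# → ∃ (IsMultOrder F x)
  order-exists {x} x≢0 with ^-period x≢0
  ... | N , xᴺ⁺¹≡1 with least-witness {P = λ k → x ^ suc k ≡ 1#} (λ k → x ^ suc k ≟ 1#) {N} xᴺ⁺¹≡1
  ...   | k , xᵏ⁺¹≡1 , least = suc k , s≤s z≤n , xᵏ⁺¹≡1 , λ { (suc j) _ xʲ⁺¹≡1 → s≤s (least j xʲ⁺¹≡1) }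

  order∣⇒^≡1 : ∀ {x A n} → IsMultOrder F x A → A ∣ n → x ^ n ≡ 1#
  order∣⇒^≡1 (_ , xᴬ≡1 , _) (divides q refl) = ^≡1⇒^-*≡1 xᴬ≡1 q

  -- x^(n mod A) = 1 with 0 < n mod A < A would contradict minimality.
  ^≡1⇒order∣ : ∀ {x A n} → IsMultOrder F x A → x ^ n ≡ 1# → A ∣ n
  ^≡1⇒order∣ {x} {A@(suc _)} {n} (0<A , xᴬ≡1 , least) xⁿ≡1 with n % A in n%A≡t
  ... | zero = m%n≡0⇒n∣m n A n%A≡t
  ... | suc t = contradiction (least (suc t) (s≤s z≤n) xᵗ⁺¹≡1) (ℕ.<⇒≱ (subst (_< A) n%A≡t (m%n<n n A)))
    where
    open ≡-Reasoning
    xᵗ⁺¹≡1 : x ^ suc t ≡ 1#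
    xᵗ⁺¹≡1 = begin
      x ^ suc t                      ≡⟨ *-identityʳ _ ⟨
      x ^ suc t * 1#                 ≡⟨ cong (x ^ suc t *_) (^≡1⇒^-*≡1 xᴬ≡1 (n / A)) ⟨
      x ^ suc t * x ^ (n / A ℕ.* A)  ≡⟨ ^-homo-+ x (suc t) (n / A ℕ.* A) ⟨
      x ^ (suc t ℕ.+ n / A ℕ.* A)    ≡⟨ cong (λ s → x ^ (s ℕ.+ n / A ℕ.* A)) n%A≡t ⟨
      x ^ (n % A ℕ.+ n / A ℕ.* A)    ≡⟨ cong (x ^_) (m≡m%n+[m/n]*n n A) ⟨
      x ^ n                          ≡⟨ xⁿ≡1 ⟩
      1#                             ∎

  orders-twoOfThree : ∀ {x y A B C} → IsMultOrder F x A → IsMultOrder F y B → IsMultOrder F (x * y) C →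
    TwoOfThree A B C
  orders-twoOfThree {x} {y} ordˣ ordʸ ordˣʸ = record
    { AB⇒C = λ {n} A∣n B∣n → ^≡1⇒order∣ ordˣʸ (begin
        (x * y) ^ n     ≡⟨ ^-distribʳ-* x y n ⟩
        x ^ n * y ^ n   ≡⟨ cong₂ _*_ (order∣⇒^≡1 ordˣ A∣n) (order∣⇒^≡1 ordʸ B∣n) ⟩
        1# * 1#         ≡⟨ *-identityˡ 1# ⟩
        1#              ∎)
    ; BC⇒A = λ {n} B∣n C∣n → ^≡1⇒order∣ ordˣ (begin
        x ^ n           ≡⟨ *-identityʳ (x ^ n) ⟨
        x ^ n * 1#      ≡⟨ cong (x ^ n *_) (order∣⇒^≡1 ordʸ B∣n) ⟨
        x ^ n * y ^ n   ≡⟨ ^-distribʳ-* x y n ⟨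
        (x * y) ^ n     ≡⟨ order∣⇒^≡1 ordˣʸ C∣n ⟩
        1#              ∎)
    ; CA⇒B = λ {n} C∣n A∣n → ^≡1⇒order∣ ordʸ (begin
        y ^ n           ≡⟨ *-identityˡ (y ^ n) ⟨
        1# * y ^ n      ≡⟨ cong (_* y ^ n) (order∣⇒^≡1 ordˣ A∣n) ⟨
        x ^ n * y ^ n   ≡⟨ ^-distribʳ-* x y n ⟨
        (x * y) ^ n     ≡⟨ order∣⇒^≡1 ordˣʸ C∣n ⟩
        1#              ∎)
    }
    where open ≡-Reasoning

  -1-order-2 : 1# + 1# ≢ 0# → IsMultOrder F (- 1#) 2
  -1-order-2 1+1≢0 = s≤s z≤n , [-1]²≡1 , least
    where
    [-1]²≡1 : (- 1#) ^ 2 ≡ 1#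
    [-1]²≡1 = trans (cong (- 1# *_) (*-identityʳ (- 1#))) (trans (-1*x≈-x (- 1#)) (-‿involutive 1#))
    1+1≡0 : (- 1#) ^ 1 ≡ 1# → 1# + 1# ≡ 0#
    1+1≡0 -1≡1 = trans (cong (1# +_) (trans (sym -1≡1) (*-identityʳ (- 1#)))) (-‿inverseʳ 1#)
    least : ∀ k → 0 < k → (- 1#) ^ k ≡ 1# → 2 ≤ k
    least 1 _ -1≡1 = contradiction (1+1≡0 -1≡1) 1+1≢0
    least (suc (suc _)) _ _ = s≤s (s≤s z≤n)

module Orbits (F : FiniteField) (a b : FiniteField.Carrier F) where
  open import Data.Nat using (_+_; _*_; _∸_; NonZero; >-nonZero)

  Q^ : ℕ → Vec2 F → Vec2 F
  Q^ = Qpow F a b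

  Q^-+ : ∀ m n v → Q^ (m + n) v ≡ Q^ m (Q^ n v)
  Q^-+ zero n v = refl
  Q^-+ (suc m) n v = cong (Qmul F a b) (Q^-+ m n v)

  IsExactPeriod : Vec2 F → ℕ → Set
  IsExactPeriod v D = ∀ n → Q^ n v ≡ v ⇔ D ∣ n

  module _ {v D} (period : IsExactPeriod v D) where

    Q^-mod : .{{_ : NonZero D}} → ∀ n → Q^ n v ≡ Q^ (n % D) v
    Q^-mod n = begin
      Q^ n v                         ≡⟨ cong (λ k → Q^ k v) (m≡m%n+[m/n]*n n D) ⟩
      Q^ (n % D + n / D * D) v       ≡⟨ Q^-+ (n % D) (n / D * D) v ⟩
      Q^ (n % D) (Q^ (n / D * D) v)  ≡⟨ cong (Q^ (n % D)) (Equivalence.from (period _) (n∣m*n (n / D))) ⟩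
      Q^ (n % D) v                   ∎
      where open ≡-Reasoning

    -- Q^i v = Q^j v would make Q^(D - j + i) fix v, and 0 < D - j + i < D.
    Q^-injective-below : ∀ {i j} → i < j → j < D → Q^ i v ≢ Q^ j v
    Q^-injective-below {i} {j} i<j j<D Qⁱv≡Qʲv =
      >⇒∤ {{>-nonZero 0<k+i}} k+i<D (Equivalence.to (period (k + i)) Qᵏ⁺ⁱv≡v)
      where
      open ≡-Reasoning
      k : ℕ
      k = D ∸ j
      k+j≡D : k + j ≡ D
      k+j≡D = ℕ.m∸n+n≡m (ℕ.<⇒≤ j<D)
      0<k+i : 0 < k + i
      0<k+i = ℕ.≤-trans (ℕ.m<n⇒0<n∸m j<D) (ℕ.m≤m+n k i)
      k+i<D : k + i < D
      k+i<D = subst (k + i <_) k+j≡D (ℕ.+-monoʳ-< k i<j)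
      Qᵏ⁺ⁱv≡v : Q^ (k + i) v ≡ v
      Qᵏ⁺ⁱv≡v = begin
        Q^ (k + i) v   ≡⟨ Q^-+ k i v ⟩
        Q^ k (Q^ i v)  ≡⟨ cong (Q^ k) Qⁱv≡Qʲv ⟩
        Q^ k (Q^ j v)  ≡⟨ Q^-+ k j v ⟨
        Q^ (k + j) v   ≡⟨ cong (λ n → Q^ n v) k+j≡D ⟩
        Q^ D v         ≡⟨ Equivalence.from (period D) ∣-refl ⟩
        v              ∎

  orbitLength : ∀ {v D} → 0 < D → IsExactPeriod v D → OrbitLength F a b v D
  orbitLength {v} {D@(suc _)} _ period =
    tabulate point , length-tabulate point , Unique.tabulate⁺ point-injective , λ w → mk⇔ (in-orbit w) (∈-points w)
    where
    point : Fin D → Vec2 F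
    point i = Q^ (toℕ i) v
    point-injective : ∀ {i j} → point i ≡ point j → i ≡ j
    point-injective {i} {j} eq with ℕ.<-cmp (toℕ i) (toℕ j)
    ... | tri< i<j _ _ = contradiction eq (Q^-injective-below period i<j (Fin.toℕ<n j))
    ... | tri≈ _ i≡j _ = Fin.toℕ-injective i≡j
    ... | tri> _ _ j<i = contradiction (sym eq) (Q^-injective-below period j<i (Fin.toℕ<n i))
    in-orbit : ∀ w → w ∈ tabulate point → InOrbit F a b v w
    in-orbit w w∈ with ∈-tabulate⁻ w∈
    ... | i , w≡pointᵢ = toℕ i , sym w≡pointᵢ
    ∈-points : ∀ w → InOrbit F a b v w → w ∈ tabulate point
    ∈-points w (n , Qⁿv≡w) = subst (_∈ tabulate point) pointᵢ≡w (∈-tabulate⁺ {f = point} i)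
      where
      i : Fin D
      i = fromℕ< (m%n<n n D)
      pointᵢ≡w : point i ≡ w
      pointᵢ≡w = trans (cong (λ k → Q^ k v) (Fin.toℕ-fromℕ< (m%n<n n D)))
                       (trans (sym (Q^-mod period n)) Qⁿv≡w)

UniformOrbitLengths : (F : FiniteField) → (a b : FiniteField.Carrier F) → ℕ → Set
UniformOrbitLengths F a b r = Σ ℕ λ m → (r ∣ m) × (∀ v → NonZeroV F v → OrbitLength F a b v m)

TwoOrbitLengths : (F : FiniteField) → (a b : FiniteField.Carrier F) → ℕ → Set
TwoOrbitLengths F a b r = Σ ℕ λ m → ¬ (r ∣ m) ×
  (∀ v → NonZeroV F v → OrbitLength F a b v m ⊎ OrbitLength F a b v (r ℕ.* m)) ×
  (∃ λ v → NonZeroV F v × OrbitLength F a b v m) ×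
  (∃ λ v → NonZeroV F v × OrbitLength F a b v (r ℕ.* m))

module Eigenforms (F : FiniteField) (a b : FiniteField.Carrier F) where
  open FieldFacts F
  open Orbits F a b

  -- When p, q are the roots of X² - aX - b, (x , y) ↦ x - q y is a left eigenvector of Q for p.
  eigenform : Carrier → Vec2 F → Carrier
  eigenform q (x , y) = x - q * y

  eigenform-Qmul : ∀ {p q} → p + q ≡ a → p * q ≡ - b → ∀ v → eigenform q (Qmul F a b v) ≡ p * eigenform q v
  eigenform-Qmul {p} {q} p+q≡a pq≡-b (x , y) = begin
    (a * x + b * y) - q * x                  ≡⟨ cong₂ (λ s t → (s * x + t * y) - q * x) (sym p+q≡a) b≡-pq ⟩
    ((p + q) * x + - (p * q) * y) - q * x    ≡⟨ cong (λ s → (s + - (p * q) * y) - q * x) (distribʳ x p q) ⟩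
    (p * x + q * x + - (p * q) * y) - q * x  ≡⟨ cong (_- q * x) (xy∙z≈xz∙y (p * x) (q * x) _) ⟩
    (p * x + - (p * q) * y + q * x) - q * x  ≡⟨ //-rightDividesʳ (q * x) _ ⟩
    p * x + - (p * q) * y                    ≡⟨ cong (p * x +_) -pq*y≡-p*qy ⟩
    p * x - p * (q * y)                      ≡⟨ x[y-z]≈xy-xz p x (q * y) ⟨
    p * (x - q * y)                          ∎
    where
    open ≡-Reasoning
    b≡-pq : b ≡ - (p * q)
    b≡-pq = trans (sym (-‿involutive b)) (cong -_ (sym pq≡-b))
    -pq*y≡-p*qy : - (p * q) * y ≡ - (p * (q * y))
    -pq*y≡-p*qy = trans (sym (-‿distribˡ-* (p * q) y)) (cong -_ (*-assoc p q y))

  eigenform-Qpow : ∀ {p q} → p + q ≡ a → p * q ≡ - b → ∀ n v → eigenform q (Q^ n v) ≡ p ^ n * eigenform q v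
  eigenform-Qpow _ _ zero v = sym (*-identityˡ _)
  eigenform-Qpow {p} {q} p+q≡a pq≡-b (suc n) v = begin
    eigenform q (Qmul F a b (Q^ n v))  ≡⟨ eigenform-Qmul p+q≡a pq≡-b (Q^ n v) ⟩
    p * eigenform q (Q^ n v)           ≡⟨ cong (p *_) (eigenform-Qpow p+q≡a pq≡-b n v) ⟩
    p * (p ^ n * eigenform q v)        ≡⟨ *-assoc p (p ^ n) _ ⟨
    p ^ suc n * eigenform q v          ∎
    where open ≡-Reasoning

  eigenform-zeroV : ∀ q → eigenform q (zeroV F) ≡ 0#
  eigenform-zeroV q = trans (cong (λ t → 0# - t) (zeroʳ q)) (-‿inverseʳ 0#)

  eigenform-difference : ∀ p q x y → eigenform p (x , y) + (p - q) * y ≡ eigenform q (x , y)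
  eigenform-difference p q x y = begin
    (x - p * y) + (p - q) * y          ≡⟨ cong ((x - p * y) +_) ([y-z]x≈yx-zx y p q) ⟩
    (x - p * y) + (p * y - q * y)      ≡⟨ +-assoc x (- (p * y)) _ ⟩
    x + (- (p * y) + (p * y - q * y))  ≡⟨ cong (x +_) (\\-leftDividesʳ (p * y) (- (q * y))) ⟩
    x - q * y                          ∎
    where open ≡-Reasoning

  module Roots {l m} (l+m≡a : l + m ≡ a) (lm≡-b : l * m ≡ - b) (l≢m : l ≢ m) where

    φ ψ : Vec2 F → Carrier
    φ = eigenform m
    ψ = eigenform l

    φ-Qpow : ∀ n v → φ (Q^ n v) ≡ l ^ n * φ v
    φ-Qpow = eigenform-Qpow l+m≡a lm≡-b

    ψ-Qpow : ∀ n v → ψ (Q^ n v) ≡ m ^ n * ψ v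
    ψ-Qpow = eigenform-Qpow (trans (+-comm m l) l+m≡a) (trans (*-comm m l) lm≡-b)

    φψ-injective : ∀ {v w} → φ v ≡ φ w → ψ v ≡ ψ w → v ≡ w
    φψ-injective {x , y} {x′ , y′} φ≡ ψ≡ = cong₂ _,_ x≡x′ y≡y′
      where
      open ≡-Reasoning
      y≡y′ : y ≡ y′
      y≡y′ = *-cancelˡ-≢0 (≢⇒-≢0 l≢m) (+-cancelˡ (ψ (x , y)) _ _ (begin
        ψ (x , y) + (l - m) * y     ≡⟨ eigenform-difference l m x y ⟩
        φ (x , y)                   ≡⟨ φ≡ ⟩
        φ (x′ , y′)                 ≡⟨ eigenform-difference l m x′ y′ ⟨
        ψ (x′ , y′) + (l - m) * y′  ≡⟨ cong (_+ (l - m) * y′) ψ≡ ⟨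
        ψ (x , y) + (l - m) * y′    ∎))
      x≡x′ : x ≡ x′
      x≡x′ = begin
        x                     ≡⟨ //-rightDividesˡ (m * y) x ⟨
        φ (x , y) + m * y     ≡⟨ cong₂ (λ s t → s + m * t) φ≡ y≡y′ ⟩
        φ (x′ , y′) + m * y′  ≡⟨ //-rightDividesˡ (m * y′) x′ ⟩
        x′                    ∎

    nonZero-φψ : ∀ {v} → NonZeroV F v → φ v ≢ 0# ⊎ (φ v ≡ 0# × ψ v ≢ 0#)
    nonZero-φψ {v} v≢0 with φ v ≟ 0# | ψ v ≟ 0#
    ... | no φ≢0 | _ = inj₁ φ≢0
    ... | yes φ≡0 | no ψ≢0 = inj₂ (φ≡0 , ψ≢0)
    ... | yes φ≡0 | yes ψ≡0 =
      contradiction (φψ-injective (trans φ≡0 (sym (eigenform-zeroV m))) (trans ψ≡0 (sym (eigenform-zeroV l)))) v≢0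

    nonZero-[_,1] : ∀ p → NonZeroV F (p , 1#)
    nonZero-[ p ,1] p,1≡0 = 0≢1 (sym (cong proj₂ p,1≡0))

    φ[l,1]≢0 : φ (l , 1#) ≢ 0#
    φ[l,1]≢0 = subst (λ t → l - t ≢ 0#) (sym (*-identityʳ m)) (≢⇒-≢0 l≢m)

    φ[m,1]≡0 : φ (m , 1#) ≡ 0#
    φ[m,1]≡0 = trans (cong (λ t → m - t) (*-identityʳ m)) (-‿inverseʳ m)

    ψ[m,1]≢0 : ψ (m , 1#) ≢ 0#
    ψ[m,1]≢0 = subst (λ t → m - t ≢ 0#) (sym (*-identityʳ l)) (≢⇒-≢0 (l≢m ∘ sym))

    module _ {A B} (ordˡ : IsMultOrder F l A) (ordᵐ : IsMultOrder F m B) where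

      fixed⇒orders∣ : ∀ {n v} → Q^ n v ≡ v → (φ v ≢ 0# → A ∣ n) × (ψ v ≢ 0# → B ∣ n)
      fixed⇒orders∣ {n} {v} Qⁿv≡v =
        (λ φ≢0 → ^≡1⇒order∣ ordˡ (*-fix⇒≡1 φ≢0 (trans (sym (φ-Qpow n v)) (cong φ Qⁿv≡v)))) ,
        (λ ψ≢0 → ^≡1⇒order∣ ordᵐ (*-fix⇒≡1 ψ≢0 (trans (sym (ψ-Qpow n v)) (cong ψ Qⁿv≡v))))

      orders∣⇒fixed : ∀ {n v} → (φ v ≢ 0# → A ∣ n) → (ψ v ≢ 0# → B ∣ n) → Q^ n v ≡ v
      orders∣⇒fixed {n} {v} A∣n B∣n = φψ-injective
        (trans (φ-Qpow n v) (≡1⇒*-fix (order∣⇒^≡1 ordˡ ∘ A∣n)))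
        (trans (ψ-Qpow n v) (≡1⇒*-fix (order∣⇒^≡1 ordᵐ ∘ B∣n)))

      orbitLength-φ≢0 : B ∣ A → ∀ {v} → φ v ≢ 0# → OrbitLength F a b v A
      orbitLength-φ≢0 B∣A φ≢0 = orbitLength (proj₁ ordˡ) λ n → mk⇔
        (λ fixed → proj₁ (fixed⇒orders∣ fixed) φ≢0)
        (λ A∣n → orders∣⇒fixed (λ _ → A∣n) (λ _ → ∣-trans B∣A A∣n))

      orbitLength-φ≡0 : ∀ {v} → φ v ≡ 0# → ψ v ≢ 0# → OrbitLength F a b v B
      orbitLength-φ≡0 φ≡0 ψ≢0 = orbitLength (proj₁ ordᵐ) λ n → mk⇔
        (λ fixed → proj₂ (fixed⇒orders∣ fixed) ψ≢0)
        (λ B∣n → orders∣⇒fixed (contradiction φ≡0) (λ _ → B∣n))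

      uniformOrbitLengths : ∀ {r} → A ≡ B → r ∣ A → UniformOrbitLengths F a b r
      uniformOrbitLengths refl r∣A = A , r∣A , λ v v≢0 →
        [ orbitLength-φ≢0 ∣-refl , (λ (φ≡0 , ψ≢0) → orbitLength-φ≡0 φ≡0 ψ≢0) ]′ (nonZero-φψ v≢0)

      twoOrbitLengths : ∀ {r} → A ≡ r ℕ.* B → ¬ r ∣ B → TwoOrbitLengths F a b r
      twoOrbitLengths {r} refl r∤B = B , r∤B ,
        (λ v v≢0 → [ inj₂ ∘ orbitLength-φ≢0 B∣rB , (λ (φ≡0 , ψ≢0) → inj₁ (orbitLength-φ≡0 φ≡0 ψ≢0)) ]′
                       (nonZero-φψ v≢0)) ,
        ((m , 1#) , nonZero-[ m ,1] , orbitLength-φ≡0 φ[m,1]≡0 ψ[m,1]≢0) ,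
        ((l , 1#) , nonZero-[ l ,1] , orbitLength-φ≢0 B∣rB φ[l,1]≢0)
        where
        B∣rB : B ∣ r ℕ.* B
        B∣rB = n∣m*n r

module _ (F : FiniteField) (a b : FiniteField.Carrier F) where
  open FieldFacts F
  open Eigenforms F a b

  orbitLengths-prime-order : b ≢ 0# → SplitsDistinct F a b → ∀ r → IsMultOrder F (- b) r → Prime r →
    UniformOrbitLengths F a b r ⊎ TwoOrbitLengths F a b r
  orbitLengths-prime-order b≢0 (l , m , l≢m , l+m≡a , lm≡-b) r ordʳ r-prime
    with order-exists (*-≢0⇒≢0ˡ lm≢0) | order-exists (*-≢0⇒≢0ʳ lm≢0)
    where
    lm≢0 : l * m ≢ 0#
    lm≢0 = subst (_≢ 0#) (sym lm≡-b) (-‿≢0 b≢0)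
  ... | A , ordˡ | B , ordᵐ
    with twoOfThree-prime-cases r-prime (proj₁ ordˡ) (proj₁ ordᵐ)
           (orders-twoOfThree ordˡ ordᵐ (subst (λ c → IsMultOrder F c r) (sym lm≡-b) ordʳ))
  ...   | inj₁ (A≡B , r∣A) = inj₁ (Roots.uniformOrbitLengths l+m≡a lm≡-b l≢m ordˡ ordᵐ A≡B r∣A)
  ...   | inj₂ (inj₁ (A≡rB , r∤B)) = inj₂ (Roots.twoOrbitLengths l+m≡a lm≡-b l≢m ordˡ ordᵐ A≡rB r∤B)
  ...   | inj₂ (inj₂ (B≡rA , r∤A)) = inj₂ (Roots.twoOrbitLengths
            (trans (+-comm m l) l+m≡a) (trans (*-comm m l) lm≡-b) (l≢m ∘ sym) ordᵐ ordˡ B≡rA r∤A)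

-- Opened only here: in the field modules above, _*_ is the field multiplication.
open import Data.Nat using (_*_)

mainTheorem4 : (F : FiniteField) → (a b : FiniteField.Carrier F) →
    ¬ (b ≡ FiniteField.0# F) → SplitsDistinct F a b →
    ((r : ℕ) → IsMultOrder F (FiniteField.-_ F b) r → Prime r →
      (Σ ℕ λ m → (r ∣ m) ×
        (∀ v → NonZeroV F v → OrbitLength F a b v m))
      ⊎
      (Σ ℕ λ m → ¬ (r ∣ m) ×
        (∀ v → NonZeroV F v → OrbitLength F a b v m ⊎ OrbitLength F a b v (r * m)) ×
        (∃ λ v → NonZeroV F v × OrbitLength F a b v m) ×
        (∃ λ v → NonZeroV F v × OrbitLength F a b v (r * m))))
    ×
    (b ≡ FiniteField.1# F →
      ¬ (FiniteField._+_ F (FiniteField.1# F) (FiniteField.1# F) ≡ FiniteField.0# F) →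
      (Σ ℕ λ m → (2 ∣ m) ×
        (∀ v → NonZeroV F v → OrbitLength F a b v m))
      ⊎
      (Σ ℕ λ m → ¬ (2 ∣ m) ×
        (∀ v → NonZeroV F v → OrbitLength F a b v m ⊎ OrbitLength F a b v (2 * m)) ×
        (∃ λ v → NonZeroV F v × OrbitLength F a b v m) ×
        (∃ λ v → NonZeroV F v × OrbitLength F a b v (2 * m))))
mainTheorem4 F a b b≢0 splits =
  orbitLengths-prime-order F a b b≢0 splits ,
  λ { refl 1+1≢0 → orbitLengths-prime-order F a b b≢0 splits 2 (FieldFacts.-1-order-2 F 1+1≢0) prime[2] }
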